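{- A connected graph $G$ is $2$-$\gamma_{\rm MB}$-critical if and only if $G$ is obtained from a star $K_{1,n}$, $n\ge 1$, with center $u$, and a disjoint complete bipartite graph $K_{2,m}$, $m\ge 2$, with bipartition $\{x_1,x_2\}$, $\{y_1,\dots,y_m\}$, by adding the two edges $ux_1$ and $ux_2$.
   Context: The Maker-Breaker domination (MBD) game on a graph $G$ is played by Dominator and Staller, who alternately select previously unselected vertices of $G$. Dominator wins if the set of vertices he has selected becomes a dominating set of $G$; Staller wins if she has selected at least one vertex of every dominating set of $G$. In the D-game Dominator moves first. $\gamma_{\rm MB}(G)$ is the minimum number $k$ such that Dominator has a strategy in the D-game guaranteeing that he wins having made at most $k$ moves, whatever Staller does; $\gamma_{\rm MB}(G)=\infty$ if Dominator has no winning strategy. A graph $G$ is $k$-$\gamma_{\rm MB}$-critical if $\gamma_{\rm MB}(G)=k$ and $\gamma_{\rm MB}(G)<\gamma_{\rm MB}(G-e)$ for every $e\in E(G)$. -}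

module Defs where

open import Data.Nat using (ℕ; zero; suc; _<_)
open import Data.Fin using (Fin)
open import Data.Fin.Properties using (_≟_)
open import Data.Bool using (Bool; true; false; _∨_; _∧_; not)
open import Data.Product using (Σ; ∃; _×_; _,_)
open import Data.Sum using (_⊎_)
open import Data.Empty using (⊥)
open import Relation.Nullary using (¬_; does)
open import Relation.Binary.PropositionalEquality using (_≡_)
open import Function.Bundles using (_↔_; Inverse)

record Graph (n : ℕ) : Set where
  field
    Adj    : Fin n → Fin n → Bool
    sym    : ∀ x y → Adj x y ≡ Adj y x
    irrefl : ∀ x → Adj x x ≡ false
open Graph public

data Walk {n : ℕ} (G : Graph n) : Fin n → Fin n → Set where
  here : ∀ {x} → Walk G x x
  step : ∀ {x y z} → Adj G x y ≡ true → Walk G y z → Walk G x z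

Connected : ∀ {n} → Graph n → Set
Connected {n} G = ∀ (x y : Fin n) → Walk G x y

deleteEdge : ∀ {n} → (G : Graph n) → Fin n → Fin n → Graph n
deleteEdge {n} G a b = record
  { Adj = adj
  ; sym = symP
  ; irrefl = irr }
  where
  isE : Fin n → Fin n → Bool
  isE x y = (does (x ≟ a) ∧ does (y ≟ b)) ∨ (does (x ≟ b) ∧ does (y ≟ a))
  adj : Fin n → Fin n → Bool
  adj x y = Adj G x y ∧ not (isE x y)
  symP : ∀ x y → adj x y ≡ adj y x
  symP x y with Adj G x y | Adj G y x | sym G x y
           | does (x ≟ a) | does (y ≟ b) | does (x ≟ b) | does (y ≟ a)
  ... | false | .false | _≡_.refl | _ | _ | _ | _ = _≡_.refl
  ... | true | .true | _≡_.refl | true  | true  | true  | true  = _≡_.refl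
  ... | true | .true | _≡_.refl | true  | true  | true  | false = _≡_.refl
  ... | true | .true | _≡_.refl | true  | true  | false | true  = _≡_.refl
  ... | true | .true | _≡_.refl | true  | true  | false | false = _≡_.refl
  ... | true | .true | _≡_.refl | true  | false | true  | true  = _≡_.refl
  ... | true | .true | _≡_.refl | true  | false | true  | false = _≡_.refl
  ... | true | .true | _≡_.refl | true  | false | false | true  = _≡_.refl
  ... | true | .true | _≡_.refl | true  | false | false | false = _≡_.refl
  ... | true | .true | _≡_.refl | false | true  | true  | true  = _≡_.refl
  ... | true | .true | _≡_.refl | false | true  | true  | false = _≡_.refl
  ... | true | .true | _≡_.refl | false | true  | false | true  = _≡_.refl
  ... | true | .true | _≡_.refl | false | true  | false | false = _≡_.refl
  ... | true | .true | _≡_.refl | false | false | true  | true  = _≡_.refl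
  ... | true | .true | _≡_.refl | false | false | true  | false = _≡_.refl
  ... | true | .true | _≡_.refl | false | false | false | true  = _≡_.refl
  ... | true | .true | _≡_.refl | false | false | false | false = _≡_.refl
  irr : ∀ x → adj x x ≡ false
  irr x with Adj G x x | irrefl G x
  ... | .false | _≡_.refl = _≡_.refl

VSet : ℕ → Set
VSet n = Fin n → Bool

∅ : ∀ {n} → VSet n
∅ _ = false

insert : ∀ {n} → Fin n → VSet n → VSet n
insert v A w = A w ∨ does (w ≟ v)

Dominating : ∀ {n} → Graph n → VSet n → Set
Dominating {n} G A = ∀ (x : Fin n) → A x ≡ true ⊎ Σ (Fin n) λ y → Adj G x y ≡ true × A y ≡ true

Unselected : ∀ {n} → VSet n → VSet n → Fin n → Set
Unselected D S v = D v ≡ false × S v ≡ false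

-- DomWins G k D S : in the position where Dominator has selected D, Staller
-- has selected S, and it is Dominator's turn, Dominator has a strategy
-- that makes his selected set dominating within at most k further moves
-- of his, whatever Staller does.  If after Dominator's move his set is not
-- dominating and no vertex is left, the game is over and Staller has won.
DomWins : ∀ {n} → Graph n → ℕ → VSet n → VSet n → Set
DomWins G zero D S = ⊥
DomWins {n} G (suc k) D S =
  Σ (Fin n) λ v → Unselected D S v ×
    ( Dominating G (insert v D)
    ⊎ ( (Σ (Fin n) λ w → Unselected (insert v D) S w)
      × (∀ w → Unselected (insert v D) S w → DomWins G k (insert v D) (insert w S))))

-- γ_MB(G) ≤ k  (in the D-game, starting from the empty position).
γMB≤ : ∀ {n} → Graph n → ℕ → Set
γMB≤ G k = DomWins G k ∅ ∅

-- γ_MB(G) = k  (k finite).  γ_MB(G) = ∞ iff there is no k with γ_MB(G) = k.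
γMB≡ : ∀ {n} → Graph n → ℕ → Set
γMB≡ G k = γMB≤ G k × (∀ j → j < k → ¬ γMB≤ G j)

-- G is k-γ_MB-critical: γ_MB(G) = k and γ_MB(G) < γ_MB(G - e) for every
-- edge e (where γ_MB(G - e) = ∞ makes the inequality hold).
Critical : ∀ {n} → Graph n → ℕ → Set
Critical {n} G k = γMB≡ G k ×
  (∀ (a b : Fin n) → Adj G a b ≡ true → ∀ j → γMB≡ (deleteEdge G a b) j → k < j)

data SKVertex (n m : ℕ) : Set where
  centre : SKVertex n m
  leaf   : Fin n → SKVertex n m
  xv     : Fin 2 → SKVertex n m
  yv     : Fin m → SKVertex n m

skAdj : ∀ {n m} → SKVertex n m → SKVertex n m → Bool
skAdj centre (leaf _) = true
skAdj (leaf _) centre = true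
skAdj centre (xv _)   = true
skAdj (xv _) centre   = true
skAdj (xv _) (yv _)   = true
skAdj (yv _) (xv _)   = true
skAdj _ _             = false

IsStarK2m : ∀ {N} → Graph N → ℕ → ℕ → Set
IsStarK2m {N} G n m = Σ (Fin N ↔ SKVertex n m) λ f →
  ∀ (a b : Fin N) → Adj G a b ≡ skAdj (Inverse.to f a) (Inverse.to f b)

{-# OPTIONS --safe #-}
-- Dominator wins within two moves iff there is a universal vertex (γ_MB = 1) or a double
-- threat: an opening v with two distinct partners p, q such that {v, p} and {v, q} both dominate.
-- Deleting an edge never creates a universal vertex, so G is 2-γ_MB-critical iff it has a double
-- threat, no universal vertex, and no double threat survives the deletion of any edge.
-- In the star joined to K_{2,m} the only dominating pairs are {u, xᵢ}, and every edge is the only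
-- link from one of its endpoints to one such pair. Conversely, fix a threat (v; p, q) in a connected
-- critical graph. A threat survives the deletion of every edge ab whose endpoints stay dominated by
-- both pairs; ruling this out forces p, q ~ v, no edges inside N(v), every vertex outside N[v]
-- adjacent to p and q and to nothing else, some further neighbour of v, and at least two vertices
-- outside N[v]. This is the star centred at v joined to K_{2,m} with parts {p, q} and V ∖ N[v].
module Submission where

open import Defs hiding (sym)
open import Data.Nat using (ℕ; zero; suc; _≤_; _<_; z≤n; s≤s)
open import Data.Nat.Properties using (_≤?_; ≤-refl; <-irrefl; ≰⇒>)
open import Data.Fin using (Fin; zero; suc)
open import Data.Fin.Properties using (_≟_; any?)
open import Data.Bool using (Bool; true; false; T; _∨_; _∧_)
open import Data.Bool.Properties
  using (∨-zeroʳ; ∧-zeroʳ; ∧-conicalˡ; ¬-not; T-irrelevant) renaming (_≟_ to _≟ᵇ_)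
open import Data.Product using (Σ; ∃; ∃₂; _×_; _,_; proj₁; proj₂)
import Data.Product as Product
open import Data.Sum using (_⊎_; inj₁; inj₂; [_,_]′; fromInj₂)
import Data.Sum as Sum
open import Data.Empty using (⊥; ⊥-elim)
open import Function using (id; _∘_)
open import Function.Bundles using (_⇔_; _↔_; Inverse; Injection; Equivalence; mk⇔; mk↔ₛ′)
open import Function.Properties.Inverse using (Inverse⇒Injection; ↔-sym)
import Function.Properties.Equivalence as ⇔
open import Relation.Nullary using (¬_; Dec; yes; no; does; ¬?; _×-dec_; _⊎-dec_)
open import Relation.Nullary.Decidable using (dec-true; dec-false; True; ⌊_⌋; toWitness; fromWitness)
open import Relation.Binary.PropositionalEquality
  using (_≡_; _≢_; refl; sym; trans; cong; cong₂; subst; subst₂; ≢-sym)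

inhabited⇒1≤ : ∀ {m} → Fin m → 1 ≤ m
inhabited⇒1≤ {suc _} _ = s≤s z≤n

distinct⇒2≤ : ∀ {m} {i j : Fin m} → i ≢ j → 2 ≤ m
distinct⇒2≤ {suc (suc _)} _                       = s≤s (s≤s z≤n)
distinct⇒2≤ {suc zero}    {zero} {zero} i≢j = ⊥-elim (i≢j refl)

enumerate : ∀ {N} (P : Fin N → Bool) → Σ ℕ λ k → Σ (Fin N) (T ∘ P) ↔ Fin k
enumerate {zero} P = 0 , mk↔ₛ′ (λ { (() , _) }) (λ ()) (λ ()) (λ { (() , _) })
enumerate {suc N} P = extend (P zero) refl (enumerate (P ∘ suc))
  where
  extend : ∀ b → P zero ≡ b → (Σ ℕ λ k → Σ (Fin N) (T ∘ P ∘ suc) ↔ Fin k) →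
           Σ ℕ λ k → Σ (Fin (suc N)) (T ∘ P) ↔ Fin k
  extend false P0≡false (k , e) = k , mk↔ₛ′ to from (Inverse.strictlyInverseˡ e) from∘to
    where
    to : Σ (Fin (suc N)) (T ∘ P) → Fin k
    to (zero , P0)  = ⊥-elim (subst T P0≡false P0)
    to (suc a , Pa) = Inverse.to e (a , Pa)
    from : Fin k → Σ (Fin (suc N)) (T ∘ P)
    from i = Product.map suc id (Inverse.from e i)
    from∘to : ∀ x → from (to x) ≡ x
    from∘to (zero , P0)  = ⊥-elim (subst T P0≡false P0)
    from∘to (suc a , Pa) = cong (Product.map suc id) (Inverse.strictlyInverseʳ e (a , Pa))
  extend true P0≡true (k , e) = suc k , mk↔ₛ′ to from to∘from from∘to
    where
    to : Σ (Fin (suc N)) (T ∘ P) → Fin (suc k)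
    to (zero , _)   = zero
    to (suc a , Pa) = suc (Inverse.to e (a , Pa))
    from : Fin (suc k) → Σ (Fin (suc N)) (T ∘ P)
    from zero    = zero , subst T (sym P0≡true) _
    from (suc i) = Product.map suc id (Inverse.from e i)
    to∘from : ∀ i → to (from i) ≡ i
    to∘from zero    = refl
    to∘from (suc i) = cong suc (Inverse.strictlyInverseˡ e i)
    from∘to : ∀ x → from (to x) ≡ x
    from∘to (zero , P0)  = cong (zero ,_) (T-irrelevant _ P0)
    from∘to (suc a , Pa) = cong (Product.map suc id) (Inverse.strictlyInverseʳ e (a , Pa))

walk-exit : ∀ {n} {G : Graph n} {P : Fin n → Set} → (∀ x → Dec (P x)) →
            ∀ {x z} → Walk G x z → P x → ¬ P z → ∃₂ λ a b → Adj G a b ≡ true × P a × ¬ P b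
walk-exit P? here Px ¬Pz = ⊥-elim (¬Pz Px)
walk-exit P? (step {x} {y} x~y walk) Px ¬Pz with P? y
... | yes Py = walk-exit P? walk Py ¬Pz
... | no ¬Py = x , y , x~y , Px , ¬Py

Fin2-cover : ∀ {i j : Fin 2} → i ≢ j → ∀ k → k ≡ i ⊎ k ≡ j
Fin2-cover {zero}     {zero}     i≢j _          = ⊥-elim (i≢j refl)
Fin2-cover {suc zero} {suc zero} i≢j _          = ⊥-elim (i≢j refl)
Fin2-cover {zero}     {suc zero} _   zero       = inj₁ refl
Fin2-cover {zero}     {suc zero} _   (suc zero) = inj₂ refl
Fin2-cover {suc zero} {zero}     _   zero       = inj₂ refl
Fin2-cover {suc zero} {zero}     _   (suc zero) = inj₁ refl

Fin2-other : Fin 2 → Fin 2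
Fin2-other zero       = suc zero
Fin2-other (suc zero) = zero

-- Domination by one or two vertices

module _ {V : Set} (adj : V → V → Bool) where

  Dominates : V → V → Set
  Dominates u x = x ≡ u ⊎ adj x u ≡ true

  Dominates₂ : V → V → V → Set
  Dominates₂ u w x = Dominates u x ⊎ Dominates w x

  Universal : V → Set
  Universal u = ∀ x → Dominates u x

  DominatingPair : V → V → Set
  DominatingPair u w = ∀ x → Dominates₂ u w x

  ¬dominates : ∀ {u x} → x ≢ u → adj x u ≡ false → ¬ Dominates u x
  ¬dominates x≢u _   (inj₁ x≡u) = x≢u x≡u
  ¬dominates _   x≁u (inj₂ x~u) with () ← trans (sym x~u) x≁u

  ¬universal : ∀ {u} x → x ≢ u → adj x u ≡ false → ¬ Universal u
  ¬universal x x≢u x≁u U = ¬dominates x≢u x≁u (U x)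

  ¬dominatingPair : ∀ {u w} x → x ≢ u → x ≢ w → adj x u ≡ false → adj x w ≡ false →
                    ¬ DominatingPair u w
  ¬dominatingPair x x≢u x≢w x≁u x≁w D =
    [ ¬dominates x≢u x≁u , ¬dominates x≢w x≁w ]′ (D x)

module _ {n : ℕ} (G : Graph n) where

  adjacent⇒≢ : ∀ {x y} → Adj G x y ≡ true → x ≢ y
  adjacent⇒≢ {x} x~y refl with () ← trans (sym x~y) (irrefl G x)

  Adj-sym : ∀ {x y β} → Adj G x y ≡ β → Adj G y x ≡ β
  Adj-sym {x} {y} x~y = trans (Graph.sym G y x) x~y

  -- Dominator opens with v; whichever of p, q Staller then takes, Dominator completes with the other.
  record DoubleThreat : Set where
    field
      v p q         : Fin n
      v≢p           : v ≢ p
      v≢q           : v ≢ q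
      p≢q           : p ≢ q
      dominating-vp : DominatingPair (Adj G) v p
      dominating-vq : DominatingPair (Adj G) v q

  DoubleThreat-swap : DoubleThreat → DoubleThreat
  DoubleThreat-swap t = record
    { v = v ; p = q ; q = p ; v≢p = v≢q ; v≢q = v≢p ; p≢q = ≢-sym p≢q
    ; dominating-vp = dominating-vq ; dominating-vq = dominating-vp }
    where open DoubleThreat t

-- Edge deletion

_⊆ᴳ_ : ∀ {n} → Graph n → Graph n → Set
H ⊆ᴳ G = ∀ {x y} → Adj H x y ≡ true → Adj G x y ≡ true

module _ {n : ℕ} (G : Graph n) (a b : Fin n) where

  private
    H = deleteEdge G a b

  deleteEdge-⊆ : H ⊆ᴳ G
  deleteEdge-⊆ {x} {y} = ∧-conicalˡ (Adj G x y) _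

  deleteEdge-nonadjacent : ∀ {x y} → Adj G x y ≡ false → Adj H x y ≡ false
  deleteEdge-nonadjacent x≁y = cong (_∧ _) x≁y

  deleteEdge-keeps : ∀ {x y} → y ≢ a → y ≢ b → Adj G x y ≡ true → Adj H x y ≡ true
  deleteEdge-keeps {x} {y} y≢a y≢b x~y
    rewrite x~y | dec-false (y ≟ b) y≢b | dec-false (y ≟ a) y≢a
          | ∧-zeroʳ (does (x ≟ a)) | ∧-zeroʳ (does (x ≟ b)) = refl

  deleteEdge-removes : Adj H a b ≡ false
  deleteEdge-removes rewrite dec-true (a ≟ a) refl | dec-true (b ≟ b) refl =
    ∧-zeroʳ (Adj G a b)

  deleteEdge-removes′ : Adj H b a ≡ false
  deleteEdge-removes′ = trans (Graph.sym H b a) deleteEdge-removes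

  deleteEdge-dominates : ∀ {u x} → u ≢ a → u ≢ b → Adj G x u ≡ true → Dominates (Adj H) u x
  deleteEdge-dominates u≢a u≢b x~u = inj₂ (deleteEdge-keeps u≢a u≢b x~u)

  deleteEdge-dominatingPair : ∀ {u w} → DominatingPair (Adj G) u w →
    Dominates₂ (Adj H) u w a → Dominates₂ (Adj H) u w b → DominatingPair (Adj H) u w
  deleteEdge-dominatingPair {u} {w} D Da Db x = by-cases (x ≟ a) (x ≟ b)
    where
    survives : ∀ {y} → x ≢ a → x ≢ b → Dominates (Adj G) y x → Dominates (Adj H) y x
    survives _   _   (inj₁ x≡y) = inj₁ x≡y
    survives x≢a x≢b (inj₂ x~y) =
      inj₂ (trans (Graph.sym H x _) (deleteEdge-keeps x≢a x≢b (Adj-sym G x~y)))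
    by-cases : Dec (x ≡ a) → Dec (x ≡ b) → Dominates₂ (Adj H) u w x
    by-cases (yes refl) _          = Da
    by-cases (no _)     (yes refl) = Db
    by-cases (no x≢a)   (no x≢b)   = Sum.map (survives x≢a x≢b) (survives x≢a x≢b) (D x)

  deleteEdge-threat : (t : DoubleThreat G) → let open DoubleThreat t in
    Dominates₂ (Adj H) v p a → Dominates₂ (Adj H) v p b →
    Dominates₂ (Adj H) v q a → Dominates₂ (Adj H) v q b → DoubleThreat H
  deleteEdge-threat t Dpa Dpb Dqa Dqb = record
    { v = v ; p = p ; q = q ; v≢p = v≢p ; v≢q = v≢q ; p≢q = p≢q
    ; dominating-vp = deleteEdge-dominatingPair dominating-vp Dpa Dpb
    ; dominating-vq = deleteEdge-dominatingPair dominating-vq Dqa Dqb }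
    where open DoubleThreat t

-- Dominator's wins within two moves

module _ {n : ℕ} where

  insert-∈ˡ : ∀ (A : VSet n) u w → A w ≡ true → insert u A w ≡ true
  insert-∈ˡ _ u w w∈A = cong (_∨ does (w ≟ u)) w∈A

  insert-∈ʳ : ∀ (A : VSet n) u → insert u A u ≡ true
  insert-∈ʳ A u = trans (cong (A u ∨_) (dec-true (u ≟ u) refl)) (∨-zeroʳ (A u))

  insert-∈⁻ : ∀ {A : VSet n} {u w} → insert u A w ≡ true → A w ≡ true ⊎ w ≡ u
  insert-∈⁻ {A} {u} {w} w∈ with A w | w ≟ u
  ... | true  | _        = inj₁ refl
  ... | false | yes w≡u  = inj₂ w≡u
  insert-∈⁻ () | false | no _

  insert-∉ : ∀ {A : VSet n} {u w} → A w ≡ false → w ≢ u → insert u A w ≡ false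
  insert-∉ {u = u} {w} w∉A w≢u = cong₂ _∨_ w∉A (dec-false (w ≟ u) w≢u)

  insert-∉⁻ : ∀ {A : VSet n} {u w} → insert u A w ≡ false → w ≢ u
  insert-∉⁻ {A} w∉ refl with () ← trans (sym (insert-∈ʳ A _)) w∉

module _ {n : ℕ} (G : Graph n) where

  dominating-singleton⇔ : ∀ {u} → Dominating G (insert u ∅) ⇔ Universal (Adj G) u
  dominating-singleton⇔ {u} = mk⇔ to from
    where
    u∈ : insert u ∅ u ≡ true
    u∈ = insert-∈ʳ ∅ u
    ∈-singleton : ∀ {y} → insert u ∅ y ≡ true → y ≡ u
    ∈-singleton y∈ with insert-∈⁻ {A = ∅} y∈
    ... | inj₂ y≡u = y≡u
    to : Dominating G (insert u ∅) → Universal (Adj G) u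
    to D x with D x
    ... | inj₁ x∈              = inj₁ (∈-singleton x∈)
    ... | inj₂ (y , x~y , y∈) with refl ← ∈-singleton {y} y∈ = inj₂ x~y
    from : Universal (Adj G) u → Dominating G (insert u ∅)
    from U x with U x
    ... | inj₁ refl = inj₁ u∈
    ... | inj₂ x~u  = inj₂ (u , x~u , u∈)

  dominating-pair⇔ : ∀ {u w} → Dominating G (insert w (insert u ∅)) ⇔ DominatingPair (Adj G) u w
  dominating-pair⇔ {u} {w} = mk⇔ to from
    where
    u∈ : insert w (insert u ∅) u ≡ true
    u∈ = insert-∈ˡ (insert u ∅) w u (insert-∈ʳ ∅ u)
    w∈ : insert w (insert u ∅) w ≡ true
    w∈ = insert-∈ʳ (insert u ∅) w
    ∈-pair : ∀ {y} → insert w (insert u ∅) y ≡ true → y ≡ u ⊎ y ≡ w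
    ∈-pair y∈ with insert-∈⁻ {A = insert u ∅} y∈
    ... | inj₂ y≡w = inj₂ y≡w
    ... | inj₁ y∈′ with insert-∈⁻ {A = ∅} y∈′
    ... | inj₂ y≡u = inj₁ y≡u
    to : Dominating G (insert w (insert u ∅)) → DominatingPair (Adj G) u w
    to D x with D x
    ... | inj₁ x∈ = Sum.map inj₁ inj₁ (∈-pair x∈)
    ... | inj₂ (y , x~y , y∈) with ∈-pair {y} y∈
    ... | inj₁ refl = inj₁ (inj₂ x~y)
    ... | inj₂ refl = inj₂ (inj₂ x~y)
    from : DominatingPair (Adj G) u w → Dominating G (insert w (insert u ∅))
    from D x with D x
    ... | inj₁ (inj₁ refl) = inj₁ u∈
    ... | inj₁ (inj₂ x~u)  = inj₂ (u , x~u , u∈)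
    ... | inj₂ (inj₁ refl) = inj₁ w∈
    ... | inj₂ (inj₂ x~w)  = inj₂ (w , x~w , w∈)

  DomWins-last : ∀ {D S} → DomWins G 1 D S → ∃ λ x → Unselected D S x × Dominating G (insert x D)
  DomWins-last (x , free , inj₁ dominating)       = x , free , dominating
  DomWins-last (_ , _ , inj₂ ((w , free) , next)) = ⊥-elim (next w free)

  universal⇒γMB≤1 : ∀ {u} → Universal (Adj G) u → γMB≤ G 1
  universal⇒γMB≤1 {u} U = u , (refl , refl) , inj₁ (Equivalence.from dominating-singleton⇔ U)

  γMB≤1⇒universal : ∀ {j} → j ≤ 1 → γMB≤ G j → ∃ (Universal (Adj G))
  γMB≤1⇒universal {1} _ win with DomWins-last win
  ... | u , _ , dominating = u , Equivalence.to dominating-singleton⇔ dominating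
  γMB≤1⇒universal {suc (suc _)} (s≤s ()) _

  threat⇒γMB≤2 : DoubleThreat G → γMB≤ G 2
  threat⇒γMB≤2 t = v , (refl , refl) , inj₂ ((p , insert-∉ refl (≢-sym v≢p) , refl) , reply)
    where
    open DoubleThreat t
    reply : ∀ w → Unselected (insert v ∅) ∅ w → DomWins G 1 (insert v ∅) (insert w ∅)
    reply w _ with w ≟ p
    ... | yes refl = q , (insert-∉ refl (≢-sym v≢q) , insert-∉ refl (≢-sym p≢q)) ,
                     inj₁ (Equivalence.from dominating-pair⇔ dominating-vq)
    ... | no w≢p   = p , (insert-∉ refl (≢-sym v≢p) , insert-∉ refl (≢-sym w≢p)) ,
                     inj₁ (Equivalence.from dominating-pair⇔ dominating-vp)

  γMB≤2⇒universal⊎threat : ∀ {j} → j ≤ 2 → γMB≤ G j → ∃ (Universal (Adj G)) ⊎ DoubleThreat G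
  γMB≤2⇒universal⊎threat {1} _ win = inj₁ (γMB≤1⇒universal ≤-refl win)
  γMB≤2⇒universal⊎threat {2} _ (v , _ , inj₁ dominating) =
    inj₁ (v , Equivalence.to dominating-singleton⇔ dominating)
  γMB≤2⇒universal⊎threat {2} _ (v , _ , inj₂ ((w , w-free) , reply))
    with DomWins-last (reply w w-free)
  ... | p , (p∉D , _) , dominating-p
    with DomWins-last (reply p (p∉D , refl))
  ... | q , (q∉D , q∉S) , dominating-q = inj₂ (record
    { v = v ; p = p ; q = q
    ; v≢p = ≢-sym (insert-∉⁻ p∉D) ; v≢q = ≢-sym (insert-∉⁻ q∉D)
    ; p≢q = ≢-sym (insert-∉⁻ q∉S)
    ; dominating-vp = Equivalence.to dominating-pair⇔ dominating-p
    ; dominating-vq = Equivalence.to dominating-pair⇔ dominating-q })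
  γMB≤2⇒universal⊎threat {suc (suc (suc _))} (s≤s (s≤s ())) _

  noUniversal⇒γMB>1 : (∀ u → ¬ Universal (Adj G) u) → ∀ j → j < 2 → ¬ γMB≤ G j
  noUniversal⇒γMB>1 no-universal j (s≤s j≤1) win =
    let (u , U) = γMB≤1⇒universal j≤1 win in no-universal u U

module _ {n : ℕ} (G : Graph n) where

  record ThreatCritical : Set where
    field
      threat       : DoubleThreat G
      no-universal : ∀ u → ¬ Universal (Adj G) u
      fragile      : ∀ a b → Adj G a b ≡ true → ¬ DoubleThreat (deleteEdge G a b)

  universal-deleteEdge : ∀ {a b u} → Universal (Adj (deleteEdge G a b)) u → Universal (Adj G) u
  universal-deleteEdge U x = Sum.map id (deleteEdge-⊆ G _ _) (U x)

  critical2⇔threatCritical : Critical G 2 ⇔ ThreatCritical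
  critical2⇔threatCritical = mk⇔ to from
    where
    to : Critical G 2 → ThreatCritical
    to ((win , minimal) , critical) = record
      { threat       = [ (λ (u , U) → ⊥-elim (no-universal u U)) , id ]′
                         (γMB≤2⇒universal⊎threat G ≤-refl win)
      ; no-universal = no-universal
      ; fragile      = λ a b a~b t → <-irrefl refl (critical a b a~b 2
          ( threat⇒γMB≤2 (deleteEdge G a b) t
          , noUniversal⇒γMB>1 (deleteEdge G a b) (λ u → no-universal u ∘ universal-deleteEdge)))
      }
      where
      no-universal : ∀ u → ¬ Universal (Adj G) u
      no-universal u U = minimal 1 ≤-refl (universal⇒γMB≤1 G U)
    from : ThreatCritical → Critical G 2
    from tc = (threat⇒γMB≤2 G threat , noUniversal⇒γMB>1 G no-universal) , beyond-2
      where
      open ThreatCritical tc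
      beyond-2 : ∀ a b → Adj G a b ≡ true → ∀ j → γMB≡ (deleteEdge G a b) j → 2 < j
      beyond-2 a b a~b j (win , _) with j ≤? 2
      ... | no j≰2  = ≰⇒> j≰2
      ... | yes j≤2 = ⊥-elim ([ (λ (u , U) → no-universal u (universal-deleteEdge U))
                                , fragile a b a~b ]′
                                (γMB≤2⇒universal⊎threat (deleteEdge G a b) j≤2 win))

-- The star joined to K_{2,m}

centre-xv-dominating : ∀ {n m} k → DominatingPair (skAdj {n} {m}) centre (xv k)
centre-xv-dominating k centre   = inj₁ (inj₁ refl)
centre-xv-dominating k (leaf _) = inj₁ (inj₂ refl)
centre-xv-dominating k (xv _)   = inj₁ (inj₂ refl)
centre-xv-dominating k (yv _)   = inj₂ (inj₂ refl)

xv≢xv-other : ∀ {n m} k → xv {n} {m} k ≢ xv (Fin2-other k)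
xv≢xv-other zero       ()
xv≢xv-other (suc zero) ()

module _ {n m : ℕ} where

  private
    SK = SKVertex (suc n) (suc (suc m))

  skAdj-no-universal : ∀ (s : SK) → ¬ Universal skAdj s
  skAdj-no-universal centre   = ¬universal skAdj (yv zero) (λ ()) refl
  skAdj-no-universal (leaf _) = ¬universal skAdj (xv zero) (λ ()) refl
  skAdj-no-universal (xv _)   = ¬universal skAdj (leaf zero) (λ ()) refl
  skAdj-no-universal (yv _)   = ¬universal skAdj centre (λ ()) refl

  IsX : SK → Set
  IsX s = ∃ λ k → s ≡ xv k

  private
    undominated : ∀ {A : Set} {s t : SK} z → z ≢ s → z ≢ t →
                  skAdj z s ≡ false → skAdj z t ≡ false → DominatingPair skAdj s t → A
    undominated z z≢s z≢t z≁s z≁t D = ⊥-elim (¬dominatingPair skAdj z z≢s z≢t z≁s z≁t D)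

  skAdj-dominatingPair-shape : ∀ {s t : SK} → DominatingPair skAdj s t →
                               s ≡ centre × IsX t ⊎ t ≡ centre × IsX s
  skAdj-dominatingPair-shape {centre} {xv k} _ = inj₁ (refl , k , refl)
  skAdj-dominatingPair-shape {xv k} {centre} _ = inj₂ (refl , k , refl)
  skAdj-dominatingPair-shape {centre} {centre} = undominated (yv zero) (λ ()) (λ ()) refl refl
  skAdj-dominatingPair-shape {centre} {leaf _} = undominated (yv zero) (λ ()) (λ ()) refl refl
  skAdj-dominatingPair-shape {centre} {yv zero} = undominated (yv (suc zero)) (λ ()) (λ ()) refl refl
  skAdj-dominatingPair-shape {centre} {yv (suc _)} = undominated (yv zero) (λ ()) (λ ()) refl refl
  skAdj-dominatingPair-shape {leaf _} {centre} = undominated (yv zero) (λ ()) (λ ()) refl refl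
  skAdj-dominatingPair-shape {leaf _} {leaf _} = undominated (yv zero) (λ ()) (λ ()) refl refl
  skAdj-dominatingPair-shape {leaf _} {xv zero} = undominated (xv (suc zero)) (λ ()) (λ ()) refl refl
  skAdj-dominatingPair-shape {leaf _} {xv (suc zero)} = undominated (xv zero) (λ ()) (λ ()) refl refl
  skAdj-dominatingPair-shape {leaf _} {yv zero} = undominated (yv (suc zero)) (λ ()) (λ ()) refl refl
  skAdj-dominatingPair-shape {leaf _} {yv (suc _)} = undominated (yv zero) (λ ()) (λ ()) refl refl
  skAdj-dominatingPair-shape {xv zero} {leaf _} = undominated (xv (suc zero)) (λ ()) (λ ()) refl refl
  skAdj-dominatingPair-shape {xv (suc zero)} {leaf _} = undominated (xv zero) (λ ()) (λ ()) refl refl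
  skAdj-dominatingPair-shape {xv _} {xv _} = undominated (leaf zero) (λ ()) (λ ()) refl refl
  skAdj-dominatingPair-shape {xv _} {yv _} = undominated (leaf zero) (λ ()) (λ ()) refl refl
  skAdj-dominatingPair-shape {yv zero} {centre} = undominated (yv (suc zero)) (λ ()) (λ ()) refl refl
  skAdj-dominatingPair-shape {yv (suc _)} {centre} = undominated (yv zero) (λ ()) (λ ()) refl refl
  skAdj-dominatingPair-shape {yv zero} {leaf _} = undominated (yv (suc zero)) (λ ()) (λ ()) refl refl
  skAdj-dominatingPair-shape {yv (suc _)} {leaf _} = undominated (yv zero) (λ ()) (λ ()) refl refl
  skAdj-dominatingPair-shape {yv _} {xv _} = undominated (leaf zero) (λ ()) (λ ()) refl refl
  skAdj-dominatingPair-shape {yv _} {yv _} = undominated (leaf zero) (λ ()) (λ ()) refl refl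

module StarK2m {N n m : ℕ} (G : Graph N) (f : Fin N ↔ SKVertex (suc n) (suc (suc m)))
               (f-adj : ∀ a b → Adj G a b ≡ skAdj (Inverse.to f a) (Inverse.to f b)) where

  private
    SK = SKVertex (suc n) (suc (suc m))
  open Inverse f using (to; from; strictlyInverseˡ; strictlyInverseʳ)

  share-image : ∀ {x y s} → to x ≡ s → to y ≡ s → x ≡ y
  share-image x↦s y↦s = Injection.injective (Inverse⇒Injection f) (trans x↦s (sym y↦s))

  from-≢ : ∀ {s t} → s ≢ t → from s ≢ from t
  from-≢ s≢t = s≢t ∘ Injection.injective (Inverse⇒Injection (↔-sym f))

  from-to : ∀ {x s} → to x ≡ s → from s ≡ x
  from-to {x} refl = strictlyInverseʳ x

  adj-from : ∀ s t → Adj G (from s) (from t) ≡ skAdj s t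
  adj-from s t = trans (f-adj (from s) (from t)) (cong₂ skAdj (strictlyInverseˡ s) (strictlyInverseˡ t))

  dominates-to : ∀ H → H ⊆ᴳ G → ∀ {u} s → Dominates (Adj H) u (from s) → Dominates skAdj (to u) s
  dominates-to _ _ s (inj₁ e) = inj₁ (trans (sym (strictlyInverseˡ s)) (cong to e))
  dominates-to _ H⊆G {u} s (inj₂ e) =
    inj₂ (subst (λ s′ → skAdj s′ (to u) ≡ true) (strictlyInverseˡ s)
                (trans (sym (f-adj (from s) u)) (H⊆G e)))

  dominates-from : ∀ {s} x → Dominates skAdj s (to x) → Dominates (Adj G) (from s) x
  dominates-from x (inj₁ e) = inj₁ (sym (from-to e))
  dominates-from {s} x (inj₂ e) =
    inj₂ (subst (λ y → Adj G y (from s) ≡ true) (strictlyInverseʳ x) (trans (adj-from (to x) s) e))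

  dominatingPair-to : ∀ H {u w} → H ⊆ᴳ G →
                      DominatingPair (Adj H) u w → DominatingPair skAdj (to u) (to w)
  dominatingPair-to H {u} {w} H⊆G D s =
    Sum.map (dominates-to H H⊆G {u} s) (dominates-to H H⊆G {w} s) (D (from s))

  dominatingPair-from : ∀ {s t} → DominatingPair skAdj s t → DominatingPair (Adj G) (from s) (from t)
  dominatingPair-from {s} {t} D x = Sum.map (dominates-from {s} x) (dominates-from {t} x) (D (to x))

  module _ (H : Graph N) (H⊆G : H ⊆ᴳ G) (t : DoubleThreat H) where
    open DoubleThreat t

    private
      shape : ∀ {w} → DominatingPair (Adj H) v w →
              to v ≡ centre × IsX (to w) ⊎ to w ≡ centre × IsX (to v)
      shape D = skAdj-dominatingPair-shape (dominatingPair-to H H⊆G D)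

      relabel : ∀ {w k} → to v ≡ centre → to w ≡ xv k → DominatingPair (Adj H) v w →
                DominatingPair (Adj H) (from centre) (from (xv k))
      relabel v↦c w↦x = subst₂ (DominatingPair (Adj H)) (sym (from-to v↦c)) (sym (from-to w↦x))

    -- The dominating pairs of the star joined to K_{2,m} are exactly {centre, xᵢ}.
    threat-canonical : ∀ k → DominatingPair (Adj H) (from centre) (from (xv k))
    threat-canonical k with shape dominating-vp | shape dominating-vq
    ... | inj₁ (v↦c , i , p↦i) | inj₁ (_ , j , q↦j) with Fin2-cover i≢j k
      where
      i≢j : i ≢ j
      i≢j refl = p≢q (share-image p↦i q↦j)
    ...   | inj₁ refl = relabel v↦c p↦i dominating-vp
    ...   | inj₂ refl = relabel v↦c q↦j dominating-vq
    threat-canonical k | inj₁ (v↦c , _) | inj₂ (q↦c , _) = ⊥-elim (v≢q (share-image v↦c q↦c))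
    threat-canonical k | inj₂ (p↦c , _) | inj₁ (v↦c , _) = ⊥-elim (v≢p (share-image v↦c p↦c))
    threat-canonical k | inj₂ (p↦c , _) | inj₂ (q↦c , _) = ⊥-elim (p≢q (share-image p↦c q↦c))

  private
    module _ {a b : Fin N} where
      H = deleteEdge G a b

      nonadjacent : ∀ z w → skAdj z w ≡ false → Adj H (from z) (from w) ≡ false
      nonadjacent z w z≁w = deleteEdge-nonadjacent G a b (trans (adj-from z w) z≁w)

      isolated : ∀ z k → z ≢ centre → z ≢ xv k →
                 Adj H (from z) (from centre) ≡ false → Adj H (from z) (from (xv k)) ≡ false →
                 ¬ DoubleThreat H
      isolated z k z≢c z≢x z≁c z≁x t =
        ¬dominatingPair (Adj H) (from z) (from-≢ z≢c) (from-≢ z≢x) z≁c z≁x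
          (threat-canonical H (deleteEdge-⊆ G a b) t k)

  -- The deleted edge was the only link from its endpoint z to the pair {centre, x_k}.
  fragile-sk : ∀ s t → skAdj s t ≡ true → ¬ DoubleThreat (deleteEdge G (from s) (from t))
  fragile-sk centre (leaf i) _ =
    isolated (leaf i) zero (λ ()) (λ ()) (deleteEdge-removes′ G _ _) (nonadjacent (leaf i) (xv zero) refl)
  fragile-sk (leaf i) centre _ =
    isolated (leaf i) zero (λ ()) (λ ()) (deleteEdge-removes G _ _) (nonadjacent (leaf i) (xv zero) refl)
  fragile-sk centre (xv k) _ =
    isolated (xv k) (Fin2-other k) (λ ()) (xv≢xv-other k) (deleteEdge-removes′ G _ _)
      (nonadjacent (xv k) (xv (Fin2-other k)) refl)
  fragile-sk (xv k) centre _ =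
    isolated (xv k) (Fin2-other k) (λ ()) (xv≢xv-other k) (deleteEdge-removes G _ _)
      (nonadjacent (xv k) (xv (Fin2-other k)) refl)
  fragile-sk (xv k) (yv l) _ =
    isolated (yv l) k (λ ()) (λ ()) (nonadjacent (yv l) centre refl) (deleteEdge-removes′ G _ _)
  fragile-sk (yv l) (xv k) _ =
    isolated (yv l) k (λ ()) (λ ()) (nonadjacent (yv l) centre refl) (deleteEdge-removes G _ _)
  fragile-sk centre   centre   ()
  fragile-sk centre   (yv _)   ()
  fragile-sk (leaf _) (leaf _) ()
  fragile-sk (leaf _) (xv _)   ()
  fragile-sk (leaf _) (yv _)   ()
  fragile-sk (xv _)   (leaf _) ()
  fragile-sk (xv _)   (xv _)   ()
  fragile-sk (yv _)   centre   ()
  fragile-sk (yv _)   (leaf _) ()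
  fragile-sk (yv _)   (yv _)   ()

  threatCritical : ThreatCritical G
  threatCritical = record
    { threat = record
      { v = from centre ; p = from (xv zero) ; q = from (xv (suc zero))
      ; v≢p = from-≢ (λ ()) ; v≢q = from-≢ (λ ()) ; p≢q = from-≢ (λ ())
      ; dominating-vp = dominatingPair-from (centre-xv-dominating zero)
      ; dominating-vq = dominatingPair-from (centre-xv-dominating (suc zero)) }
    ; no-universal = λ u U → skAdj-no-universal (to u) (λ s → dominates-to G id s (U (from s)))
    ; fragile = λ a b a~b →
        subst₂ (λ a b → ¬ DoubleThreat (deleteEdge G a b)) (strictlyInverseʳ a) (strictlyInverseʳ b)
          (fragile-sk (to a) (to b) (trans (sym (f-adj a b)) a~b))
    }

starK2m⇒threatCritical : ∀ {N} (G : Graph N) →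
  (Σ ℕ λ n → Σ ℕ λ m → 1 ≤ n × 2 ≤ m × IsStarK2m G n m) → ThreatCritical G
starK2m⇒threatCritical G (suc _ , suc (suc _) , s≤s z≤n , s≤s (s≤s z≤n) , f , f-adj) =
  StarK2m.threatCritical G f f-adj

-- Connected threat-critical graphs

module _ {N : ℕ} (G : Graph N) (connected : Connected G) (tc : ThreatCritical G) (t : DoubleThreat G) where
  open ThreatCritical tc using (fragile)
  open DoubleThreat t

  private
    dominates? : ∀ u x → Dec (Dominates (Adj G) u x)
    dominates? u x = (x ≟ u) ⊎-dec (Adj G x u ≟ᵇ true)

    outside⇒partner : ∀ {r x} → ¬ Dominates (Adj G) v x → DominatingPair (Adj G) v r →
                      Dominates (Adj G) r x
    outside⇒partner {x = x} x∉N[v] D = fromInj₂ (⊥-elim ∘ x∉N[v]) (D x)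

    p∉N[v] : Adj G p v ≡ false → ¬ Dominates (Adj G) v p
    p∉N[v] p≁v = ¬dominates (Adj G) (≢-sym v≢p) p≁v

    both-outside : Adj G p v ≡ false → Adj G q v ≡ false → ⊥
    both-outside p≁v q≁v with walk-exit (dominates? v) (connected v p) (inj₁ refl) (p∉N[v] p≁v)
    ... | a , b , a~b , inj₁ refl , b∉N[v] = b∉N[v] (inj₂ (Adj-sym G a~b))
    ... | a , b , a~b , inj₂ a~v  , b∉N[v] = fragile a b a~b
          (deleteEdge-threat G a b t via-v (via p≁v dominating-vp) via-v (via q≁v dominating-vq))
      where
      v≢b : v ≢ b
      v≢b v≡b = b∉N[v] (inj₁ (sym v≡b))
      via-v : ∀ {r} → Dominates₂ (Adj (deleteEdge G a b)) v r a
      via-v = inj₁ (deleteEdge-dominates G a b (≢-sym (adjacent⇒≢ G a~v)) v≢b a~v)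
      via : ∀ {r} → Adj G r v ≡ false → DominatingPair (Adj G) v r →
            Dominates₂ (Adj (deleteEdge G a b)) v r b
      via r≁v D with outside⇒partner b∉N[v] D
      ... | inj₁ b≡r = inj₂ (inj₁ b≡r)
      ... | inj₂ b~r = inj₂ (deleteEdge-dominates G a b r≢a (≢-sym (adjacent⇒≢ G b~r)) b~r)
        where
        r≢a : _ ≢ a
        r≢a refl with () ← trans (sym a~v) r≁v

  -- If p ≁ v, the threat survives deleting vq when q ~ v (as q ~ p), and otherwise survives
  -- deleting the edge through which a walk from v to p leaves N[v].
  partner-adjacent : Adj G p v ≡ true
  partner-adjacent with Adj G p v in p-v | Adj G q v in q-v
  ... | true  | _     = refl
  ... | false | false = ⊥-elim (both-outside p-v q-v)
  ... | false | true  = ⊥-elim (fragile v q (Adj-sym G q-v)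
          (deleteEdge-threat G v q t (inj₁ (inj₁ refl)) q-via-p (inj₁ (inj₁ refl)) (inj₂ (inj₁ refl))))
    where
    q-via-p : Dominates₂ (Adj (deleteEdge G v q)) v p q
    q-via-p with outside⇒partner (p∉N[v] p-v) dominating-vq
    ... | inj₁ p≡q = ⊥-elim (p≢q p≡q)
    ... | inj₂ p~q = inj₂ (deleteEdge-dominates G v q (≢-sym v≢p) p≢q (Adj-sym G p~q))

-- v, p, q become u, x₁, x₂; Leaf and Outer are the leaves of the star and the yⱼ.
module ThreatCriticalStructure {N : ℕ} (G : Graph N) (connected : Connected G) (tc : ThreatCritical G) where
  open ThreatCritical tc
  open DoubleThreat threat

  p~v : Adj G p v ≡ true
  p~v = partner-adjacent G connected tc threat

  q~v : Adj G q v ≡ true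
  q~v = partner-adjacent G connected tc (DoubleThreat-swap G threat)

  Leaf : Fin N → Set
  Leaf x = Adj G x v ≡ true × x ≢ p × x ≢ q

  Outer : Fin N → Set
  Outer x = x ≢ v × Adj G x v ≡ false

  leaf? : ∀ x → Dec (Leaf x)
  leaf? x = (Adj G x v ≟ᵇ true) ×-dec (¬? (x ≟ p) ×-dec ¬? (x ≟ q))

  outer? : ∀ x → Dec (Outer x)
  outer? x = ¬? (x ≟ v) ×-dec (Adj G x v ≟ᵇ false)

  neighbour≢outer : ∀ {r x} → Adj G r v ≡ true → Outer x → r ≢ x
  neighbour≢outer r~v (_ , r≁v) refl with () ← trans (sym r~v) r≁v

  outer-adjacent : ∀ {r x} → DominatingPair (Adj G) v r → Adj G r v ≡ true →
                   Outer x → Adj G x r ≡ true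
  outer-adjacent {r} {x} D r~v (x≢v , x≁v) with D x
  ... | inj₁ x∈N[v]     = ⊥-elim (¬dominates (Adj G) x≢v x≁v x∈N[v])
  ... | inj₂ (inj₁ x≡r) = ⊥-elim (neighbour≢outer r~v (x≢v , x≁v) (sym x≡r))
  ... | inj₂ (inj₂ x~r) = x~r

  outer-p : ∀ {x} → Outer x → Adj G x p ≡ true
  outer-p = outer-adjacent dominating-vp p~v

  outer-q : ∀ {x} → Outer x → Adj G x q ≡ true
  outer-q = outer-adjacent dominating-vq q~v

  private
    module _ {a b : Fin N} where
      via-v : ∀ {x r} → v ≢ a → v ≢ b → Adj G x v ≡ true →
              Dominates₂ (Adj (deleteEdge G a b)) v r x
      via-v v≢a v≢b x~v = inj₁ (deleteEdge-dominates G a b v≢a v≢b x~v)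

  neighbours-nonadjacent : ∀ {a b} → Adj G a v ≡ true → Adj G b v ≡ true → Adj G a b ≡ false
  neighbours-nonadjacent {a} {b} a~v b~v = ¬-not λ a~b →
    fragile a b a~b (deleteEdge-threat G a b threat
      (via-v v≢a v≢b a~v) (via-v v≢a v≢b b~v) (via-v v≢a v≢b a~v) (via-v v≢a v≢b b~v))
    where
    v≢a = ≢-sym (adjacent⇒≢ G a~v)
    v≢b = ≢-sym (adjacent⇒≢ G b~v)

  outers-nonadjacent : ∀ {a b} → Outer a → Outer b → Adj G a b ≡ false
  outers-nonadjacent {a} {b} a-outer b-outer = ¬-not λ a~b →
    fragile a b a~b (deleteEdge-threat G a b threat
      (via p~v (outer-p a-outer)) (via p~v (outer-p b-outer))
      (via q~v (outer-q a-outer)) (via q~v (outer-q b-outer)))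
    where
    via : ∀ {x r} → Adj G r v ≡ true → Adj G x r ≡ true → Dominates₂ (Adj (deleteEdge G a b)) v r x
    via r~v x~r =
      inj₂ (deleteEdge-dominates G a b (neighbour≢outer r~v a-outer) (neighbour≢outer r~v b-outer) x~r)

  outer-leaf-nonadjacent : ∀ {a b} → Outer a → Leaf b → Adj G a b ≡ false
  outer-leaf-nonadjacent {a} {b} a-outer@(a≢v , _) (b~v , b≢p , b≢q) = ¬-not λ a~b →
    fragile a b a~b (deleteEdge-threat G a b threat
      (inj₂ (deleteEdge-dominates G a b (neighbour≢outer p~v a-outer) (≢-sym b≢p) (outer-p a-outer)))
      (via-v (≢-sym a≢v) (≢-sym (adjacent⇒≢ G b~v)) b~v)
      (inj₂ (deleteEdge-dominates G a b (neighbour≢outer q~v a-outer) (≢-sym b≢q) (outer-q a-outer)))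
      (via-v (≢-sym a≢v) (≢-sym (adjacent⇒≢ G b~v)) b~v))

  data Kind (x : Fin N) : Set where
    is-v     : x ≡ v → Kind x
    is-p     : x ≡ p → Kind x
    is-q     : x ≡ q → Kind x
    is-leaf  : Leaf x → Kind x
    is-outer : Outer x → Kind x

  kind : ∀ x → Kind x
  kind x with x ≟ v | x ≟ p | x ≟ q | Adj G x v in x~v
  ... | yes x≡v | _       | _       | _     = is-v x≡v
  ... | no _    | yes x≡p | _       | _     = is-p x≡p
  ... | no _    | no _    | yes x≡q | _     = is-q x≡q
  ... | no _    | no x≢p  | no x≢q  | true  = is-leaf (x~v , x≢p , x≢q)
  ... | no x≢v  | no _    | no _    | false = is-outer (x≢v , x~v)

  some-outer : ∃ Outer
  some-outer with any? outer?
  ... | yes found = found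
  ... | no ∄outer = ⊥-elim (no-universal v v-universal)
    where
    v-universal : Universal (Adj G) v
    v-universal x with kind x
    ... | is-v x≡v              = inj₁ x≡v
    ... | is-p refl             = inj₂ p~v
    ... | is-q refl             = inj₂ q~v
    ... | is-leaf (x~v , _)     = inj₂ x~v
    ... | is-outer x-outer      = ⊥-elim (∄outer (x , x-outer))

  y₀ : Fin N
  y₀ = proj₁ some-outer

  y₀-outer : Outer y₀
  y₀-outer = proj₂ some-outer

  -- Without leaves (q; p, y₀) is a double threat surviving the deletion of vp.
  some-leaf : ∃ Leaf
  some-leaf with any? leaf?
  ... | yes found = found
  ... | no ∄leaf = ⊥-elim (fragile v p (Adj-sym G p~v)
                     (deleteEdge-threat G v p threat′ v-via-q (inj₂ (inj₁ refl)) v-via-q p-via-y₀))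
    where
    y₀≢v = proj₁ y₀-outer
    y₀≢p = ≢-sym (neighbour≢outer p~v y₀-outer)
    q≢y₀ = neighbour≢outer q~v y₀-outer
    v-via-q : ∀ {r} → Dominates₂ (Adj (deleteEdge G v p)) q r v
    v-via-q = inj₁ (deleteEdge-dominates G v p (≢-sym v≢q) (≢-sym p≢q) (Adj-sym G q~v))
    p-via-y₀ : Dominates₂ (Adj (deleteEdge G v p)) q y₀ p
    p-via-y₀ = inj₂ (deleteEdge-dominates G v p y₀≢v y₀≢p (Adj-sym G (outer-p y₀-outer)))
    qp-dominating : DominatingPair (Adj G) q p
    qp-dominating x with kind x
    ... | is-v refl              = inj₁ (inj₂ (Adj-sym G q~v))
    ... | is-p x≡p               = inj₂ (inj₁ x≡p)
    ... | is-q x≡q               = inj₁ (inj₁ x≡q)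
    ... | is-leaf x-leaf         = ⊥-elim (∄leaf (x , x-leaf))
    ... | is-outer x-outer       = inj₁ (inj₂ (outer-q x-outer))
    qy₀-dominating : DominatingPair (Adj G) q y₀
    qy₀-dominating x with kind x
    ... | is-v refl              = inj₁ (inj₂ (Adj-sym G q~v))
    ... | is-p refl              = inj₂ (inj₂ (Adj-sym G (outer-p y₀-outer)))
    ... | is-q x≡q               = inj₁ (inj₁ x≡q)
    ... | is-leaf x-leaf         = ⊥-elim (∄leaf (x , x-leaf))
    ... | is-outer x-outer       = inj₁ (inj₂ (outer-q x-outer))
    threat′ : DoubleThreat G
    threat′ = record
      { v = q ; p = p ; q = y₀ ; v≢p = ≢-sym p≢q ; v≢q = q≢y₀ ; p≢q = ≢-sym y₀≢p
      ; dominating-vp = qp-dominating ; dominating-vq = qy₀-dominating }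

  -- If y₀ is the only outer vertex, (v; q, y₀) is a double threat surviving the deletion of py₀.
  another-outer : ∃ λ y → Outer y × y ≢ y₀
  another-outer with any? (λ x → outer? x ×-dec ¬? (x ≟ y₀))
  ... | yes found = found
  ... | no ∄outer = ⊥-elim (fragile p y₀ (Adj-sym G (outer-p y₀-outer))
                      (deleteEdge-threat G p y₀ threat′ p-via-v y₀-via-q p-via-v (inj₂ (inj₁ refl))))
    where
    v≢y₀ = ≢-sym (proj₁ y₀-outer)
    q≢y₀ = neighbour≢outer q~v y₀-outer
    p-via-v : ∀ {r} → Dominates₂ (Adj (deleteEdge G p y₀)) v r p
    p-via-v = inj₁ (deleteEdge-dominates G p y₀ v≢p v≢y₀ p~v)
    y₀-via-q : Dominates₂ (Adj (deleteEdge G p y₀)) v q y₀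
    y₀-via-q = inj₂ (deleteEdge-dominates G p y₀ (≢-sym p≢q) q≢y₀ (outer-q y₀-outer))
    vy₀-dominating : DominatingPair (Adj G) v y₀
    vy₀-dominating x with kind x
    ... | is-v x≡v          = inj₁ (inj₁ x≡v)
    ... | is-p refl         = inj₁ (inj₂ p~v)
    ... | is-q refl         = inj₁ (inj₂ q~v)
    ... | is-leaf (x~v , _) = inj₁ (inj₂ x~v)
    ... | is-outer x-outer with x ≟ y₀
    ...   | yes x≡y₀ = inj₂ (inj₁ x≡y₀)
    ...   | no x≢y₀  = ⊥-elim (∄outer (x , x-outer , x≢y₀))
    threat′ : DoubleThreat G
    threat′ = record
      { v = v ; p = q ; q = y₀ ; v≢p = v≢q ; v≢q = v≢y₀ ; p≢q = q≢y₀
      ; dominating-vp = dominating-vq ; dominating-vq = vy₀-dominating }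

  nL : ℕ
  nL = proj₁ (enumerate (⌊_⌋ ∘ leaf?))

  leaves : Σ (Fin N) (True ∘ leaf?) ↔ Fin nL
  leaves = proj₂ (enumerate (⌊_⌋ ∘ leaf?))

  nO : ℕ
  nO = proj₁ (enumerate (⌊_⌋ ∘ outer?))

  outers : Σ (Fin N) (True ∘ outer?) ↔ Fin nO
  outers = proj₂ (enumerate (⌊_⌋ ∘ outer?))

  leaf-index : ∀ {x} → Leaf x → Fin nL
  leaf-index {x} x-leaf = Inverse.to leaves (x , fromWitness x-leaf)

  outer-index : ∀ {x} → Outer x → Fin nO
  outer-index {x} x-outer = Inverse.to outers (x , fromWitness x-outer)

  toSK : ∀ {x} → Kind x → SKVertex nL nO
  toSK (is-v _)         = centre
  toSK (is-p _)         = xv zero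
  toSK (is-q _)         = xv (suc zero)
  toSK (is-leaf x-leaf)   = leaf (leaf-index x-leaf)
  toSK (is-outer x-outer) = yv (outer-index x-outer)

  fromSK : SKVertex nL nO → Fin N
  fromSK centre          = v
  fromSK (leaf i)        = proj₁ (Inverse.from leaves i)
  fromSK (xv zero)       = p
  fromSK (xv (suc zero)) = q
  fromSK (yv j)          = proj₁ (Inverse.from outers j)

  toSK-unique : ∀ {x} (c d : Kind x) → toSK c ≡ toSK d
  toSK-unique (is-v _)     (is-v _)     = refl
  toSK-unique (is-p _)     (is-p _)     = refl
  toSK-unique (is-q _)     (is-q _)     = refl
  toSK-unique {x} (is-leaf _)  (is-leaf _)  = cong (λ w → leaf (Inverse.to leaves (x , w))) (T-irrelevant _ _)
  toSK-unique {x} (is-outer _) (is-outer _) = cong (λ w → yv (Inverse.to outers (x , w))) (T-irrelevant _ _)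
  toSK-unique (is-v refl)  (is-p x≡p)   = ⊥-elim (v≢p x≡p)
  toSK-unique (is-v refl)  (is-q x≡q)   = ⊥-elim (v≢q x≡q)
  toSK-unique (is-v refl)  (is-leaf (x~v , _))  = ⊥-elim (adjacent⇒≢ G x~v refl)
  toSK-unique (is-v x≡v)   (is-outer (x≢v , _)) = ⊥-elim (x≢v x≡v)
  toSK-unique (is-p refl)  (is-v x≡v)   = ⊥-elim (v≢p (sym x≡v))
  toSK-unique (is-p refl)  (is-q x≡q)   = ⊥-elim (p≢q x≡q)
  toSK-unique (is-p x≡p)   (is-leaf (_ , x≢p , _))  = ⊥-elim (x≢p x≡p)
  toSK-unique (is-p refl)  (is-outer x-outer)       = ⊥-elim (neighbour≢outer p~v x-outer refl)
  toSK-unique (is-q refl)  (is-v x≡v)   = ⊥-elim (v≢q (sym x≡v))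
  toSK-unique (is-q refl)  (is-p x≡p)   = ⊥-elim (p≢q (sym x≡p))
  toSK-unique (is-q x≡q)   (is-leaf (_ , _ , x≢q))  = ⊥-elim (x≢q x≡q)
  toSK-unique (is-q refl)  (is-outer x-outer)       = ⊥-elim (neighbour≢outer q~v x-outer refl)
  toSK-unique (is-leaf (x~v , _)) (is-v refl)       = ⊥-elim (adjacent⇒≢ G x~v refl)
  toSK-unique (is-leaf (_ , x≢p , _)) (is-p x≡p)    = ⊥-elim (x≢p x≡p)
  toSK-unique (is-leaf (_ , _ , x≢q)) (is-q x≡q)    = ⊥-elim (x≢q x≡q)
  toSK-unique (is-leaf (x~v , _)) (is-outer x-outer) = ⊥-elim (neighbour≢outer x~v x-outer refl)
  toSK-unique (is-outer (x≢v , _)) (is-v x≡v)       = ⊥-elim (x≢v x≡v)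
  toSK-unique (is-outer x-outer) (is-p refl)        = ⊥-elim (neighbour≢outer p~v x-outer refl)
  toSK-unique (is-outer x-outer) (is-q refl)        = ⊥-elim (neighbour≢outer q~v x-outer refl)
  toSK-unique (is-outer x-outer) (is-leaf (x~v , _)) = ⊥-elim (neighbour≢outer x~v x-outer refl)

  fromSK-toSK : ∀ {x} (c : Kind x) → fromSK (toSK c) ≡ x
  fromSK-toSK (is-v x≡v)         = sym x≡v
  fromSK-toSK (is-p x≡p)         = sym x≡p
  fromSK-toSK (is-q x≡q)         = sym x≡q
  fromSK-toSK {x} (is-leaf x-leaf)   = cong proj₁ (Inverse.strictlyInverseʳ leaves (x , fromWitness x-leaf))
  fromSK-toSK {x} (is-outer x-outer) = cong proj₁ (Inverse.strictlyInverseʳ outers (x , fromWitness x-outer))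

  toSK-fromSK : ∀ s → toSK (kind (fromSK s)) ≡ s
  toSK-fromSK centre          = toSK-unique (kind v) (is-v refl)
  toSK-fromSK (xv zero)       = toSK-unique (kind p) (is-p refl)
  toSK-fromSK (xv (suc zero)) = toSK-unique (kind q) (is-q refl)
  toSK-fromSK (leaf i) =
    trans (toSK-unique (kind x) (is-leaf (toWitness x∈)))
          (cong leaf (trans (cong (λ w → Inverse.to leaves (x , w)) (T-irrelevant _ x∈))
                            (Inverse.strictlyInverseˡ leaves i)))
    where
    x  = proj₁ (Inverse.from leaves i)
    x∈ = proj₂ (Inverse.from leaves i)
  toSK-fromSK (yv j) =
    trans (toSK-unique (kind y) (is-outer (toWitness y∈)))
          (cong yv (trans (cong (λ w → Inverse.to outers (y , w)) (T-irrelevant _ y∈))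
                          (Inverse.strictlyInverseˡ outers j)))
    where
    y  = proj₁ (Inverse.from outers j)
    y∈ = proj₂ (Inverse.from outers j)

  adjacency : ∀ {a b} (c : Kind a) (d : Kind b) → Adj G a b ≡ skAdj (toSK c) (toSK d)
  adjacency (is-v refl) (is-v refl)           = irrefl G v
  adjacency (is-v refl) (is-p refl)           = Adj-sym G p~v
  adjacency (is-v refl) (is-q refl)           = Adj-sym G q~v
  adjacency (is-v refl) (is-leaf (b~v , _))   = Adj-sym G b~v
  adjacency (is-v refl) (is-outer (_ , b≁v))  = Adj-sym G b≁v
  adjacency (is-p refl) (is-v refl)           = p~v
  adjacency (is-p refl) (is-p refl)           = irrefl G p
  adjacency (is-p refl) (is-q refl)           = neighbours-nonadjacent p~v q~v
  adjacency (is-p refl) (is-leaf (b~v , _))   = neighbours-nonadjacent p~v b~v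
  adjacency (is-p refl) (is-outer b-outer)    = Adj-sym G (outer-p b-outer)
  adjacency (is-q refl) (is-v refl)           = q~v
  adjacency (is-q refl) (is-p refl)           = neighbours-nonadjacent q~v p~v
  adjacency (is-q refl) (is-q refl)           = irrefl G q
  adjacency (is-q refl) (is-leaf (b~v , _))   = neighbours-nonadjacent q~v b~v
  adjacency (is-q refl) (is-outer b-outer)    = Adj-sym G (outer-q b-outer)
  adjacency (is-leaf (a~v , _)) (is-v refl)   = a~v
  adjacency (is-leaf (a~v , _)) (is-p refl)   = neighbours-nonadjacent a~v p~v
  adjacency (is-leaf (a~v , _)) (is-q refl)   = neighbours-nonadjacent a~v q~v
  adjacency (is-leaf (a~v , _)) (is-leaf (b~v , _)) = neighbours-nonadjacent a~v b~v
  adjacency (is-leaf a-leaf) (is-outer b-outer)     = Adj-sym G (outer-leaf-nonadjacent b-outer a-leaf)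
  adjacency (is-outer (_ , a≁v)) (is-v refl)  = a≁v
  adjacency (is-outer a-outer) (is-p refl)    = outer-p a-outer
  adjacency (is-outer a-outer) (is-q refl)    = outer-q a-outer
  adjacency (is-outer a-outer) (is-leaf b-leaf)     = outer-leaf-nonadjacent a-outer b-leaf
  adjacency (is-outer a-outer) (is-outer b-outer)   = outers-nonadjacent a-outer b-outer

  starK2m : Σ ℕ λ n → Σ ℕ λ m → 1 ≤ n × 2 ≤ m × IsStarK2m G n m
  starK2m = nL , nO
    , inhabited⇒1≤ (leaf-index (proj₂ some-leaf))
    , distinct⇒2≤ indices-differ
    , mk↔ₛ′ (toSK ∘ kind) fromSK toSK-fromSK (fromSK-toSK ∘ kind)
    , λ a b → adjacency (kind a) (kind b)
    where
    indices-differ : outer-index (proj₁ (proj₂ another-outer)) ≢ outer-index y₀-outer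
    indices-differ =
      proj₂ (proj₂ another-outer) ∘ cong proj₁ ∘ Injection.injective (Inverse⇒Injection outers)

threatCritical⇔starK2m : ∀ {N} (G : Graph N) → Connected G →
  ThreatCritical G ⇔ (Σ ℕ λ n → Σ ℕ λ m → 1 ≤ n × 2 ≤ m × IsStarK2m G n m)
threatCritical⇔starK2m G connected =
  mk⇔ (ThreatCriticalStructure.starK2m G connected) (starK2m⇒threatCritical G)

theorem4p3 : ∀ {N : ℕ} (G : Graph N) → Connected G →
    (Critical G 2 ⇔ Σ ℕ λ n → Σ ℕ λ m → 1 ≤ n × 2 ≤ m × IsStarK2m G n m)
theorem4p3 G connected = ⇔.trans (critical2⇔threatCritical G) (threatCritical⇔starK2m G connected)
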